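{- Let $p$ be a prime number whose last decimal digit is $1$. Let $a,b$ be natural numbers such that $p+10=(10a+7)(10b+3)$, and let $x_0$ be a positive rational number such that $p=(10x_0+7)(10b+3)$. Put $A=a+1$ and $X_0=x_0+1$. Then: (1) if $A\ge 31$, then $1<\dfrac{A}{X_0}<\left(1+\dfrac{10}{p}\right)\cdot\dfrac{101}{100}$; (2) if $X_0\ge 3.3$, then $\dfrac{10(p+10)}{11p}<\dfrac{A}{X_0}<\dfrac{101(p+10)}{100p}$. -}

module Defs where

open import Data.Nat using (ℕ)
open import Data.Rational using (ℚ; _+_; _÷_; 1ℚ; Positive; NonZero)
open import Data.Rational.Properties using (pos+nonNeg⇒pos; pos⇒nonZero)

X₀-of : ℚ → ℚ
X₀-of x₀ = x₀ + 1ℚ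

X₀-pos : (x₀ : ℚ) → .{{Positive x₀}} → Positive (X₀-of x₀)
X₀-pos x₀ = pos+nonNeg⇒pos x₀ 1ℚ {{_}}

_over-X₀-of_ : ℚ → (x₀ : ℚ) → .{{Positive x₀}} → ℚ
_over-X₀-of_ A x₀ = _÷_ A (X₀-of x₀) {{pos⇒nonZero (X₀-of x₀) {{X₀-pos x₀}}}}

{-# OPTIONS --safe #-}
-- With X₀ = x₀ + 1, A = a + 1, c = 10b + 3 and s = 3/10 the two factorisations read
-- p = 10c(X₀ − s) and p + 10 = 10c(A − s), so X₀ < A and (p + 10)/p = (A − s)/(X₀ − s).
-- Lowering numerator and denominator of A/X₀ > 1 by the same s > 0 raises the ratio, whence
-- A/X₀ < (p + 10)/p, which gives both upper bounds.  For the lower bound,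
-- 11A(X₀ − s) − 10(A − s)X₀ = A(X₀ − 11s) + 10sX₀ is positive once X₀ ≥ 11s = 3.3.

module Submission where

open import Defs
open import Data.Nat using (ℕ; _%_)
open import Data.Nat.Properties using (m*n≢0)
open import Data.Nat.Primality using (Prime; prime⇒nonZero)
open import Data.Integer using (+_)
open import Data.Rational using (ℚ; 0ℚ; 1ℚ; _<_; _≤_; _+_; _*_; _/_; positive)
open import Data.Product using (_×_)
open import Relation.Binary.PropositionalEquality using (_≡_)

import Data.Nat as ℕ
import Data.Nat.Properties as ℕ
import Data.Integer as ℤ
import Data.Integer.Properties as ℤ
import Data.Rational.Unnormalised as ℚᵘ
import Data.Rational.Unnormalised.Properties as ℚᵘ
open import Data.Rational using (_-_; -_; 1/_; _÷_; Positive; NonNegative; NonZero; toℚᵘ; nonNegative)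
open import Data.Rational.Properties
open import Data.Rational.Solver using (module +-*-Solver)
open import Algebra.Bundles using (CommutativeMonoid)
open import Algebra.Properties.CommutativeSemigroup (CommutativeMonoid.commutativeSemigroup *-1-commutativeMonoid) using (xy∙z≈xz∙y; x∙yz≈y∙xz)
open import Data.Product using (_,_)
open import Relation.Nullary.Decidable using (toWitness)
open import Relation.Binary.PropositionalEquality using (refl; sym; trans; cong; cong₂; subst; subst₂; module ≡-Reasoning)

fromℕ : ℕ → ℚ
fromℕ n = + n / 1

fromℕ-pos : ∀ n .{{_ : ℕ.NonZero n}} → Positive (fromℕ n)
fromℕ-pos n = normalize-pos n 1

fromℕ-homo-+ : ∀ m n → fromℕ (m ℕ.+ n) ≡ fromℕ m + fromℕ n
fromℕ-homo-+ m n = toℚᵘ-injective (begin-equality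
  toℚᵘ (fromℕ (m ℕ.+ n))               ≃⟨ toℚᵘ-fromℚᵘ (ℚᵘ.mkℚᵘ (+ (m ℕ.+ n)) 0) ⟩
  ℚᵘ.mkℚᵘ (+ (m ℕ.+ n)) 0              ≃⟨ ℚᵘ.*≡* (cong (ℤ._* + 1) numerators) ⟩
  ℚᵘ.mkℚᵘ (+ m) 0 ℚᵘ.+ ℚᵘ.mkℚᵘ (+ n) 0  ≃⟨ ℚᵘ.+-cong (toℚᵘ-fromℚᵘ (ℚᵘ.mkℚᵘ (+ m) 0)) (toℚᵘ-fromℚᵘ (ℚᵘ.mkℚᵘ (+ n) 0)) ⟨
  toℚᵘ (fromℕ m) ℚᵘ.+ toℚᵘ (fromℕ n)    ≃⟨ toℚᵘ-homo-+ (fromℕ m) (fromℕ n) ⟨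
  toℚᵘ (fromℕ m + fromℕ n)              ∎)
  where
  open ℚᵘ.≤-Reasoning
  numerators : + (m ℕ.+ n) ≡ + m ℤ.* + 1 ℤ.+ + n ℤ.* + 1
  numerators = trans (ℤ.pos-+ m n) (sym (cong₂ ℤ._+_ (ℤ.*-identityʳ (+ m)) (ℤ.*-identityʳ (+ n))))

fromℕ-homo-* : ∀ m n → fromℕ (m ℕ.* n) ≡ fromℕ m * fromℕ n
fromℕ-homo-* m n = toℚᵘ-injective (begin-equality
  toℚᵘ (fromℕ (m ℕ.* n))               ≃⟨ toℚᵘ-fromℚᵘ (ℚᵘ.mkℚᵘ (+ (m ℕ.* n)) 0) ⟩
  ℚᵘ.mkℚᵘ (+ (m ℕ.* n)) 0              ≃⟨ ℚᵘ.*≡* (cong (ℤ._* + 1) (ℤ.pos-* m n)) ⟩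
  ℚᵘ.mkℚᵘ (+ m) 0 ℚᵘ.* ℚᵘ.mkℚᵘ (+ n) 0  ≃⟨ ℚᵘ.*-cong (toℚᵘ-fromℚᵘ (ℚᵘ.mkℚᵘ (+ m) 0)) (toℚᵘ-fromℚᵘ (ℚᵘ.mkℚᵘ (+ n) 0)) ⟨
  toℚᵘ (fromℕ m) ℚᵘ.* toℚᵘ (fromℕ n)    ≃⟨ toℚᵘ-homo-* (fromℕ m) (fromℕ n) ⟨
  toℚᵘ (fromℕ m * fromℕ n)              ∎)
  where open ℚᵘ.≤-Reasoning

n/d*d≡n : ∀ n d .{{_ : ℕ.NonZero d}} → (+ n / d) * fromℕ d ≡ fromℕ n
n/d*d≡n n d@(ℕ.suc d-1) = toℚᵘ-injective (begin-equality
  toℚᵘ ((+ n / d) * fromℕ d)              ≃⟨ toℚᵘ-homo-* (+ n / d) (fromℕ d) ⟩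
  toℚᵘ (+ n / d) ℚᵘ.* toℚᵘ (fromℕ d)      ≃⟨ ℚᵘ.*-cong (toℚᵘ-fromℚᵘ (ℚᵘ.mkℚᵘ (+ n) d-1)) (toℚᵘ-fromℚᵘ (ℚᵘ.mkℚᵘ (+ d) 0)) ⟩
  ℚᵘ.mkℚᵘ (+ n) d-1 ℚᵘ.* ℚᵘ.mkℚᵘ (+ d) 0  ≃⟨ ℚᵘ.*≡* cross ⟩
  ℚᵘ.mkℚᵘ (+ n) 0                         ≃⟨ toℚᵘ-fromℚᵘ (ℚᵘ.mkℚᵘ (+ n) 0) ⟨
  toℚᵘ (fromℕ n)                          ∎)
  where
  open ℚᵘ.≤-Reasoning
  cross : (+ n ℤ.* + d) ℤ.* + 1 ≡ + n ℤ.* + (d ℕ.* 1)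
  cross = trans (ℤ.*-identityʳ _) (cong (λ k → + n ℤ.* + k) (sym (ℕ.*-identityʳ d)))

p<p+q : ∀ p q .{{_ : Positive q}} → p < p + q
p<p+q p q = subst (_< p + q) (+-identityʳ p) (+-monoʳ-< p (positive⁻¹ q))

p<q⇒0<q-p : ∀ {p q} → p < q → 0ℚ < q - p
p<q⇒0<q-p {p} {q} p<q = subst (_< q - p) (+-inverseʳ p) (+-monoˡ-< (- p) p<q)

p≤q⇒0≤q-p : ∀ {p q} → p ≤ q → 0ℚ ≤ q - p
p≤q⇒0≤q-p {p} {q} p≤q = subst (_≤ q - p) (+-inverseʳ p) (+-monoˡ-≤ (- p) p≤q)

p≤q*p : ∀ p .{{_ : NonNegative p}} {q} → 1ℚ ≤ q → p ≤ q * p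
p≤q*p p {q} 1≤q = subst (_≤ q * p) (*-identityˡ p) (*-monoʳ-≤-nonNeg p 1≤q)

p÷q*q≡p : ∀ p q .{{_ : NonZero q}} → (p ÷ q) * q ≡ p
p÷q*q≡p p q = begin
  p * 1/ q * q    ≡⟨ *-assoc p (1/ q) q ⟩
  p * (1/ q * q)  ≡⟨ cong (p *_) (*-inverseˡ q) ⟩
  p * 1ℚ          ≡⟨ *-identityʳ p ⟩
  p               ∎
  where open ≡-Reasoning

*<⇒<÷ : ∀ {u} p q .{{_ : NonZero q}} .{{_ : Positive q}} → u * q < p → u < p ÷ q
*<⇒<÷ {u} p q uq<p = *-cancelʳ-<-nonNeg q {{pos⇒nonNeg q}} (subst (u * q <_) (sym (p÷q*q≡p p q)) uq<p)

<*⇒÷< : ∀ {v} p q .{{_ : NonZero q}} .{{_ : Positive q}} → p < v * q → p ÷ q < v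
<*⇒÷< {v} p q p<vq = *-cancelʳ-<-nonNeg q {{pos⇒nonNeg q}} (subst (_< v * q) (sym (p÷q*q≡p p q)) p<vq)

*<*⇒<÷ : ∀ {u} p q d .{{_ : NonZero q}} .{{_ : Positive q}} .{{_ : Positive d}} →
         (u * d) * q < p * d → u < p ÷ q
*<*⇒<÷ {u} p q d h = *<⇒<÷ p q (*-cancelʳ-<-nonNeg d {{pos⇒nonNeg d}} (subst (_< p * d) (xy∙z≈xz∙y u d q) h))

<*⇒÷<* : ∀ {v} p q d .{{_ : NonZero q}} .{{_ : Positive q}} .{{_ : Positive d}} →
         p * d < (v * d) * q → p ÷ q < v
<*⇒÷<* {v} p q d h = <*⇒÷< p q (*-cancelʳ-<-nonNeg d {{pos⇒nonNeg d}} (subst (p * d <_) (xy∙z≈xz∙y v d q) h))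

+-cancelʳ-< : ∀ r {p q} → p + r < q + r → p < q
+-cancelʳ-< r {p} {q} p+r<q+r = subst₂ _<_ (p+r-r≡p p) (p+r-r≡p q) (+-monoˡ-< (- r) p+r<q+r)
  where
  p+r-r≡p : ∀ p → p + r - r ≡ p
  p+r-r≡p p = trans (+-assoc p r (- r)) (trans (cong (_+_ p) (+-inverseʳ r)) (+-identityʳ p))

ratio<shifted-ratio : ∀ {s a x} .{{_ : Positive s}} → x < a → a * (x - s) < x * (a - s)
ratio<shifted-ratio {s} {a} {x} x<a =
  subst (a * (x - s) <_) (sym gap) (p<p+q (a * (x - s)) (s * (a - x)) {{s*[a-x]>0}})
  where
  open +-*-Solver
  gap : x * (a - s) ≡ a * (x - s) + s * (a - x)
  gap = solve 3 (λ s a x → x :* (a :- s) := a :* (x :- s) :+ s :* (a :- x)) refl s a x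
  s*[a-x]>0 : Positive (s * (a - x))
  s*[a-x]>0 = pos*pos⇒pos s (a - x) {{positive (p<q⇒0<q-p x<a)}}

10/11*shifted-ratio<ratio : ∀ {s a x} .{{_ : Positive s}} .{{_ : NonNegative a}} .{{_ : Positive x}} →
                            fromℕ 11 * s ≤ x → fromℕ 10 * ((a - s) * x) < fromℕ 11 * (a * (x - s))
10/11*shifted-ratio<ratio {s} {a} {x} 11s≤x =
  subst (fromℕ 10 * ((a - s) * x) <_) (sym gap) (p<p+q (fromℕ 10 * ((a - s) * x)) slack {{slack>0}})
  where
  open +-*-Solver
  slack : ℚ
  slack = a * (x - fromℕ 11 * s) + fromℕ 10 * (s * x)
  gap : fromℕ 11 * (a * (x - s)) ≡ fromℕ 10 * ((a - s) * x) + slack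
  gap = solve 3 (λ s a x → con (fromℕ 11) :* (a :* (x :- s))
                         := con (fromℕ 10) :* ((a :- s) :* x) :+ (a :* (x :- con (fromℕ 11) :* s) :+ con (fromℕ 10) :* (s :* x)))
              refl s a x
  slack>0 : Positive slack
  slack>0 = nonNeg+pos⇒pos (a * (x - fromℕ 11 * s))
              {{nonNeg*nonNeg⇒nonNeg a (x - fromℕ 11 * s) {{nonNegative (p≤q⇒0≤q-p 11s≤x)}}}}
              (fromℕ 10 * (s * x)) {{pos*pos⇒pos (fromℕ 10) (s * x) {{pos*pos⇒pos s x}}}}

module Factorisations {p a b : ℕ} {x₀ : ℚ} .{{_ : ℕ.NonZero p}} .{{_ : Positive x₀}}
  (factorisation : p ℕ.+ 10 ≡ (10 ℕ.* a ℕ.+ 7) ℕ.* (10 ℕ.* b ℕ.+ 3))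
  (p-factorisation : fromℕ p ≡ (fromℕ 10 * x₀ + fromℕ 7) * fromℕ (10 ℕ.* b ℕ.+ 3))
  where

  P Q A X k s : ℚ
  P = fromℕ p
  Q = fromℕ (p ℕ.+ 10)
  A = fromℕ (a ℕ.+ 1)
  X = x₀ + 1ℚ
  k = fromℕ 10 * fromℕ (10 ℕ.* b ℕ.+ 3)
  s = + 3 / 10

  instance
    11p≢0 : ℕ.NonZero (11 ℕ.* p)
    11p≢0 = m*n≢0 11 p
    100p≢0 : ℕ.NonZero (100 ℕ.* p)
    100p≢0 = m*n≢0 100 p
    P>0 : Positive P
    P>0 = fromℕ-pos p
    11p>0 : Positive (fromℕ (11 ℕ.* p))
    11p>0 = fromℕ-pos (11 ℕ.* p)
    100p>0 : Positive (fromℕ (100 ℕ.* p))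
    100p>0 = fromℕ-pos (100 ℕ.* p)
    k>0 : Positive k
    k>0 = pos*pos⇒pos (fromℕ 10) (fromℕ (10 ℕ.* b ℕ.+ 3)) {{fromℕ-pos (10 ℕ.* b ℕ.+ 3) {{ℕ.≢-nonZero (ℕ.m+1+n≢0 (10 ℕ.* b))}}}}
    X>0 : Positive X
    X>0 = X₀-pos x₀
    X≢0 : NonZero X
    X≢0 = pos⇒nonZero X
    A≥0 : NonNegative A
    A≥0 = normalize-nonNeg (a ℕ.+ 1) 1
    s>0 : Positive s
    s>0 = _

  P≡[X-s]*k : P ≡ (X - s) * k
  P≡[X-s]*k = trans p-factorisation (solve 2 (λ x c → (con (fromℕ 10) :* x :+ con (fromℕ 7)) :* c
                                                := (x :+ con 1ℚ :- con s) :* (con (fromℕ 10) :* c)) refl x₀ (fromℕ (10 ℕ.* b ℕ.+ 3)))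
    where open +-*-Solver

  Q≡[A-s]*k : Q ≡ (A - s) * k
  Q≡[A-s]*k = begin
    fromℕ (p ℕ.+ 10)                                  ≡⟨ cong fromℕ factorisation ⟩
    fromℕ ((10 ℕ.* a ℕ.+ 7) ℕ.* (10 ℕ.* b ℕ.+ 3))      ≡⟨ fromℕ-homo-* (10 ℕ.* a ℕ.+ 7) (10 ℕ.* b ℕ.+ 3) ⟩
    fromℕ (10 ℕ.* a ℕ.+ 7) * c                        ≡⟨ cong (_* c) (trans (fromℕ-homo-+ (10 ℕ.* a) 7) (cong (_+ fromℕ 7) (fromℕ-homo-* 10 a))) ⟩
    (fromℕ 10 * fromℕ a + fromℕ 7) * c                ≡⟨ solve 2 (λ a c → (con (fromℕ 10) :* a :+ con (fromℕ 7)) :* c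
                                                                   := (a :+ con 1ℚ :- con s) :* (con (fromℕ 10) :* c)) refl (fromℕ a) c ⟩
    (fromℕ a + 1ℚ - s) * k                            ≡⟨ cong (λ y → (y - s) * k) (fromℕ-homo-+ a 1) ⟨
    (A - s) * k                                       ∎
    where
    open ≡-Reasoning
    open +-*-Solver
    c : ℚ
    c = fromℕ (10 ℕ.* b ℕ.+ 3)

  X<A : X < A
  X<A = +-cancelʳ-< (- s) (*-cancelʳ-<-nonNeg k {{pos⇒nonNeg k}} (subst₂ _<_ P≡[X-s]*k Q≡[A-s]*k P<Q))
    where
    P<Q : P < Q
    P<Q = subst (P <_) (sym (fromℕ-homo-+ p 10)) (p<p+q P (fromℕ 10))

  A*P<Q*X : A * P < Q * X
  A*P<Q*X = subst₂ _<_ (trans (*-assoc A (X - s) k) (cong (A *_) (sym P≡[X-s]*k)))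
                       (trans (*-assoc X (A - s) k) (trans (cong (X *_) (sym Q≡[A-s]*k)) (*-comm X Q)))
                       (*-monoˡ-<-pos k (ratio<shifted-ratio {s} X<A))

  A*P<101/100*[Q*X] : A * P < + 101 / 100 * (Q * X)
  A*P<101/100*[Q*X] = <-≤-trans A*P<Q*X (p≤q*p (Q * X) {{QX≥0}} (toWitness {a? = 1ℚ ≤? + 101 / 100} _))
    where
    QX≥0 : NonNegative (Q * X)
    QX≥0 = nonNeg*nonNeg⇒nonNeg Q {{normalize-nonNeg (p ℕ.+ 10) 1}} X {{pos⇒nonNeg X}}

  10*[Q*X]<11*[A*P] : + 33 / 10 ≤ X → fromℕ 10 * (Q * X) < fromℕ 11 * (A * P)
  10*[Q*X]<11*[A*P] 33/10≤X =
    subst₂ _<_ lhs rhs (*-monoˡ-<-pos k (10/11*shifted-ratio<ratio {s} {A} {X} 33/10≤X))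
    where
    open +-*-Solver
    lhs : fromℕ 10 * ((A - s) * X) * k ≡ fromℕ 10 * (Q * X)
    lhs = trans (solve 3 (λ u x k → con (fromℕ 10) :* (u :* x) :* k := con (fromℕ 10) :* ((u :* k) :* x)) refl (A - s) X k)
                (cong (λ q → fromℕ 10 * (q * X)) (sym Q≡[A-s]*k))
    rhs : fromℕ 11 * (A * (X - s)) * k ≡ fromℕ 11 * (A * P)
    rhs = trans (solve 3 (λ a u k → con (fromℕ 11) :* (a :* u) :* k := con (fromℕ 11) :* (a :* (u :* k))) refl A (X - s) k)
                (cong (λ q → fromℕ 11 * (A * q)) (sym P≡[X-s]*k))

  multiple-of-Q*X : ∀ m d .{{_ : ℕ.NonZero d}} → fromℕ m * (Q * X) ≡ (+ (m ℕ.* (p ℕ.+ 10)) / d * fromℕ d) * X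
  multiple-of-Q*X m d = begin
    fromℕ m * (Q * X)                                ≡⟨ *-assoc (fromℕ m) Q X ⟨
    fromℕ m * Q * X                                  ≡⟨ cong (_* X) (fromℕ-homo-* m (p ℕ.+ 10)) ⟨
    fromℕ (m ℕ.* (p ℕ.+ 10)) * X                     ≡⟨ cong (_* X) (n/d*d≡n (m ℕ.* (p ℕ.+ 10)) d) ⟨
    (+ (m ℕ.* (p ℕ.+ 10)) / d * fromℕ d) * X         ∎
    where open ≡-Reasoning

  multiple-of-A*P : ∀ m → fromℕ m * (A * P) ≡ A * fromℕ (m ℕ.* p)
  multiple-of-A*P m = trans (x∙yz≈y∙xz (fromℕ m) A P) (cong (A *_) (sym (fromℕ-homo-* m p)))

  1<A÷X : 1ℚ < A ÷ X
  1<A÷X = *<⇒<÷ A X (subst (_< A) (sym (*-identityˡ X)) X<A)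

  A÷X<[1+10/p]*101/100 : A ÷ X < (1ℚ + + 10 / p) * (+ 101 / 100)
  A÷X<[1+10/p]*101/100 = <*⇒÷<* A X P (subst (A * P <_) rearrange A*P<101/100*[Q*X])
    where
    open ≡-Reasoning
    open +-*-Solver
    [1+10/p]*P≡Q : (1ℚ + + 10 / p) * P ≡ Q
    [1+10/p]*P≡Q = begin
      (1ℚ + + 10 / p) * P        ≡⟨ *-distribʳ-+ P 1ℚ (+ 10 / p) ⟩
      1ℚ * P + + 10 / p * P      ≡⟨ cong₂ _+_ (*-identityˡ P) (n/d*d≡n 10 p) ⟩
      P + fromℕ 10               ≡⟨ fromℕ-homo-+ p 10 ⟨
      Q                          ∎
    rearrange : + 101 / 100 * (Q * X) ≡ (1ℚ + + 10 / p) * (+ 101 / 100) * P * X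
    rearrange = begin
      + 101 / 100 * (Q * X)                             ≡⟨ cong (λ q → + 101 / 100 * (q * X)) [1+10/p]*P≡Q ⟨
      + 101 / 100 * ((1ℚ + + 10 / p) * P * X)           ≡⟨ solve 4 (λ k u v x → k :* (u :* v :* x) := u :* k :* v :* x)
                                                                   refl (+ 101 / 100) (1ℚ + + 10 / p) P X ⟩
      (1ℚ + + 10 / p) * (+ 101 / 100) * P * X           ∎

  10[p+10]/11p<A÷X : + 33 / 10 ≤ X → + (10 ℕ.* (p ℕ.+ 10)) / (11 ℕ.* p) < A ÷ X
  10[p+10]/11p<A÷X 33/10≤X = *<*⇒<÷ A X (fromℕ (11 ℕ.* p))
    (subst₂ _<_ (multiple-of-Q*X 10 (11 ℕ.* p)) (multiple-of-A*P 11) (10*[Q*X]<11*[A*P] 33/10≤X))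

  A÷X<101[p+10]/100p : A ÷ X < + (101 ℕ.* (p ℕ.+ 10)) / (100 ℕ.* p)
  A÷X<101[p+10]/100p = <*⇒÷<* A X (fromℕ (100 ℕ.* p))
    (subst₂ _<_ (multiple-of-A*P 100) rearrange (*-monoʳ-<-pos (fromℕ 100) A*P<101/100*[Q*X]))
    where
    open +-*-Solver
    rearrange : fromℕ 100 * (+ 101 / 100 * (Q * X)) ≡ (+ (101 ℕ.* (p ℕ.+ 10)) / (100 ℕ.* p) * fromℕ (100 ℕ.* p)) * X
    rearrange = trans (solve 1 (λ y → con (fromℕ 100) :* (con (+ 101 / 100) :* y) := con (fromℕ 101) :* y) refl (Q * X))
                                 (multiple-of-Q*X 101 (100 ℕ.* p))

theorem3 : (p a b : ℕ) (x₀ : ℚ) → (pp : Prime p) → p % 10 ≡ 1 →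
           p Data.Nat.+ 10 ≡ (10 Data.Nat.* a Data.Nat.+ 7) Data.Nat.* (10 Data.Nat.* b Data.Nat.+ 3) →
           (x₀pos : 0ℚ < x₀) →
           (+ p) / 1 ≡ ((+ 10) / 1 * x₀ + (+ 7) / 1) * ((+ (10 Data.Nat.* b Data.Nat.+ 3)) / 1) →
           let A = (+ (a Data.Nat.+ 1)) / 1
               X₀ = x₀ + 1ℚ
               r = _over-X₀-of_ A x₀ {{positive x₀pos}}
           in ((+ 31) / 1 ≤ A → 1ℚ < r × r < (1ℚ + _/_ (+ 10) p {{prime⇒nonZero pp}}) * ((+ 101) / 100))
            × ((+ 33) / 10 ≤ X₀ → _/_ (+ (10 Data.Nat.* (p Data.Nat.+ 10))) (11 Data.Nat.* p) {{m*n≢0 11 p {{_}} {{prime⇒nonZero pp}}}} < r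
                                  × r < _/_ (+ (101 Data.Nat.* (p Data.Nat.+ 10))) (100 Data.Nat.* p) {{m*n≢0 100 p {{_}} {{prime⇒nonZero pp}}}})
theorem3 p a b x₀ pp _ factorisation x₀>0 p-factorisation =
  (λ _ → 1<A÷X , A÷X<[1+10/p]*101/100) , (λ 33/10≤X → 10[p+10]/11p<A÷X 33/10≤X , A÷X<101[p+10]/100p)
  where open Factorisations {p} {a} {b} {x₀} {{prime⇒nonZero pp}} {{positive x₀>0}} factorisation p-factorisation
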